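{- If $G$ and $H$ are finite simple graphs without vertices of degree 0 that are both efficient open domination graphs, then $\gamma_{tR}(G\times H)\le 2\rho_o(G)\rho_o(H)$.
   Context: An open packing of $G$ is a set $D\subseteq V(G)$ with $N(u)\cap N(v)=\emptyset$ for all distinct $u,v\in D$ ($N(\cdot)$ the open neighborhood); $\rho_o(G)$ is the maximum size of an open packing. A total dominating set is a set $D$ such that every vertex of $G$ has a neighbor in $D$. $G$ is an efficient open domination graph if it has a total dominating set that is also an open packing. A function $f:V(G)\to\{0,1,2\}$ with $V_i=f^{ -1}(i)$ is a total Roman dominating function if every vertex in $V_0$ has a neighbor in $V_2$ and the subgraph induced by $V_1\cup V_2$ has no isolated vertices; $\gamma_{tR}(G)$ is the minimum of $\sum_v f(v)$ over such $f$. The direct product $G\times H$ has vertex set $V(G)\times V(H)$, with $(g,h)(g',h')$ an edge iff $gg'\in E(G)$ and $hh'\in E(H)$. -}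

module Defs where

open import Data.Nat using (ℕ; _*_; _≤_)
open import Data.Fin using (Fin; remQuot; toℕ)
open import Data.Fin.Subset using (Subset; _∈_; ∣_∣)
open import Data.Vec using (sum; tabulate)
open import Data.Product using (Σ; ∃; _×_; proj₁; proj₂)
open import Relation.Nullary using (¬_; Dec)
open import Relation.Binary.PropositionalEquality using (_≡_; _≢_)

record Graph : Set₁ where
  field
    n      : ℕ
    Adj    : Fin n → Fin n → Set
    adj?   : ∀ u v → Dec (Adj u v)
    sym    : ∀ {u v} → Adj u v → Adj v u
    irrefl : ∀ {u} → ¬ Adj u u
open Graph public

NoIsolated : Graph → Set
NoIsolated G = ∀ v → ∃ λ u → Adj G v u

IsOpenPacking : (G : Graph) → Subset (n G) → Set
IsOpenPacking G D = ∀ u v → u ∈ D → v ∈ D → u ≢ v →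
  ¬ (∃ λ w → Adj G u w × Adj G v w)

IsTotalDominating : (G : Graph) → Subset (n G) → Set
IsTotalDominating G D = ∀ v → ∃ λ u → u ∈ D × Adj G v u

IsEfficientOpenDomination : Graph → Set
IsEfficientOpenDomination G =
  ∃ λ D → IsTotalDominating G D × IsOpenPacking G D

IsOpenPackingNumber : Graph → ℕ → Set
IsOpenPackingNumber G k =
  (∃ λ D → IsOpenPacking G D × ∣ D ∣ ≡ k) ×
  (∀ D → IsOpenPacking G D → ∣ D ∣ ≤ k)

-- total Roman dominating functions f : V → {0,1,2} (values as Fin 3)
IsTRDF : (G : Graph) → (Fin (n G) → Fin 3) → Set
IsTRDF G f =
  (∀ v → toℕ (f v) ≡ 0 → ∃ λ u → Adj G v u × toℕ (f u) ≡ 2) ×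
  (∀ v → toℕ (f v) ≢ 0 → ∃ λ u → Adj G v u × toℕ (f u) ≢ 0)

weight : (G : Graph) → (Fin (n G) → Fin 3) → ℕ
weight G f = sum (tabulate (λ v → toℕ (f v)))

IsTotalRomanDomNumber : Graph → ℕ → Set
IsTotalRomanDomNumber G g =
  (∃ λ f → IsTRDF G f × weight G f ≡ g) ×
  (∀ f → IsTRDF G f → g ≤ weight G f)

-- direct (tensor) product; vertex set Fin (n G * n H) ≅ Fin (n G) × Fin (n H)
-- via Data.Fin.remQuot / combine
module _ (G H : Graph) where
  private
    π₁ : Fin (n G * n H) → Fin (n G)
    π₁ x = proj₁ (remQuot {n G} (n H) x)
    π₂ : Fin (n G * n H) → Fin (n H)
    π₂ x = proj₂ (remQuot {n G} (n H) x)

  _×ᵍ_ : Graph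
  _×ᵍ_ = record
    { n = n G * n H
    ; Adj = λ x y → Adj G (π₁ x) (π₁ y) × Adj H (π₂ x) (π₂ y)
    ; adj? = λ x y → adj? G (π₁ x) (π₁ y) Relation.Nullary.×-dec adj? H (π₂ x) (π₂ y)
    ; sym = λ { (a , b) → sym G a , sym H b }
    ; irrefl = λ { (a , b) → irrefl G a }
    }
    where open import Data.Product using (_,_)

-- The bound is the composite of two general facts.
--   (1) For any graph P and total dominating set D of P, the function that is
--       2 on D and 0 elsewhere is a total Roman dominating function of weight
--       2∣D∣ (every vertex has a neighbour labelled 2, in particular every
--       labelled vertex does); hence γ_tR(P) ≤ 2∣D∣.
--   (2) If D and E are total dominating sets of G and H, then D ⊗ E (pairs
--       with both coordinates chosen) is a total dominating set of G × H, and
--       ∣D ⊗ E∣ = ∣D∣∣E∣.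
-- An efficient open dominating set is in particular an open packing, so its
-- size is at most the open packing number, and the theorem follows.
module Submission where

open import Defs hiding (sym)
open import Data.Nat using (ℕ; zero; suc; _+_; _*_; _≤_)
open import Data.Nat.Properties
  using (+-assoc; *-zeroʳ; *-distribˡ-+; *-distribʳ-+; *-assoc; *-monoʳ-≤; *-mono-≤; module ≤-Reasoning)
open import Data.Bool using (Bool; true; false; _∧_)
open import Data.Fin as Fin using (Fin; toℕ; combine; quotient; remainder; _↑ˡ_; _↑ʳ_)
open import Data.Fin.Properties using (remQuot-combine; splitAt-↑ˡ; splitAt-↑ʳ)
open import Data.Fin.Subset using (Subset; _∈_; ∣_∣)
open import Data.Vec using ([]; _∷_; sum; tabulate; lookup)
open import Data.Vec.Properties using (tabulate-cong; lookup∘tabulate; []=⇒lookup; lookup⇒[]=)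
open import Data.Product using (∃; _×_; _,_; proj₁; proj₂)
open import Relation.Binary.PropositionalEquality
  using (_≡_; _≢_; refl; sym; trans; cong; cong₂; subst; module ≡-Reasoning)

-- Finite sums over Fin m; note that  weight P f  is literally  ∑ (toℕ ∘ f).
∑ : ∀ {m} → (Fin m → ℕ) → ℕ
∑ f = sum (tabulate f)

∑-cong : ∀ {m} {f g : Fin m → ℕ} → (∀ i → f i ≡ g i) → ∑ f ≡ ∑ g
∑-cong f≗g = cong sum (tabulate-cong f≗g)

∑-*ˡ : ∀ {m} c (f : Fin m → ℕ) → ∑ (λ i → c * f i) ≡ c * ∑ f
∑-*ˡ {zero}  c f = sym (*-zeroʳ c)
∑-*ˡ {suc m} c f =
  trans (cong (c * f Fin.zero +_) (∑-*ˡ c (λ i → f (Fin.suc i))))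
        (sym (*-distribˡ-+ c (f Fin.zero) _))

∑-*ʳ : ∀ {m} c (f : Fin m → ℕ) → ∑ (λ i → f i * c) ≡ ∑ f * c
∑-*ʳ {zero}  c f = refl
∑-*ʳ {suc m} c f =
  trans (cong (f Fin.zero * c +_) (∑-*ʳ c (λ i → f (Fin.suc i))))
        (sym (*-distribʳ-+ c (f Fin.zero) _))

∑-split : ∀ m n (h : Fin (m + n) → ℕ) →
  ∑ h ≡ ∑ (λ i → h (i ↑ˡ n)) + ∑ (λ j → h (m ↑ʳ j))
∑-split zero    n h = refl
∑-split (suc m) n h =
  trans (cong (h Fin.zero +_) (∑-split m n (λ x → h (Fin.suc x))))
        (sym (+-assoc (h Fin.zero) _ _))

∑-product : ∀ m n (h : Fin m → Fin n → ℕ) →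
  ∑ {m * n} (λ x → h (quotient n x) (remainder {m} n x)) ≡ ∑ (λ i → ∑ (h i))
∑-product zero    n h = refl
∑-product (suc m) n h = begin
  ∑ h′                                                   ≡⟨ ∑-split n (m * n) h′ ⟩
  ∑ (λ j → h′ (j ↑ˡ (m * n))) + ∑ (λ y → h′ (n ↑ʳ y))   ≡⟨ cong₂ _+_ (∑-cong firstRow) (∑-cong laterRows) ⟩
  ∑ (h Fin.zero) + ∑ (λ y → h″ (quotient n y) (remainder {m} n y))
                                                         ≡⟨ cong (∑ (h Fin.zero) +_) (∑-product m n h″) ⟩
  ∑ (λ i → ∑ (h i))                                      ∎
  where
  open ≡-Reasoning
  h′ : Fin (suc m * n) → ℕ
  h′ x = h (quotient n x) (remainder {suc m} n x)
  h″ : Fin m → Fin n → ℕ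
  h″ i = h (Fin.suc i)
  firstRow : ∀ j → h′ (j ↑ˡ (m * n)) ≡ h Fin.zero j
  firstRow j rewrite splitAt-↑ˡ n j (m * n) = refl
  laterRows : ∀ y → h′ (n ↑ʳ y) ≡ h″ (quotient n y) (remainder {m} n y)
  laterRows y rewrite splitAt-↑ʳ n (m * n) y = refl

∑-separable : ∀ {m n} (a : Fin m → ℕ) (b : Fin n → ℕ) →
  ∑ {m * n} (λ x → a (quotient n x) * b (remainder {m} n x)) ≡ ∑ a * ∑ b
∑-separable {m} {n} a b = begin
  ∑ {m * n} (λ x → a (quotient n x) * b (remainder {m} n x)) ≡⟨ ∑-product m n (λ i j → a i * b j) ⟩
  ∑ (λ i → ∑ (λ j → a i * b j))                              ≡⟨ ∑-cong (λ i → ∑-*ˡ (a i) b) ⟩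
  ∑ (λ i → a i * ∑ b)                                        ≡⟨ ∑-*ʳ (∑ b) a ⟩
  ∑ a * ∑ b                                                  ∎
  where open ≡-Reasoning

bit : Bool → ℕ
bit true  = 1
bit false = 0

bit-∧ : ∀ a b → bit (a ∧ b) ≡ bit a * bit b
bit-∧ true  true  = refl
bit-∧ true  false = refl
bit-∧ false _     = refl

∣∣-as-∑ : ∀ {m} (D : Subset m) → ∣ D ∣ ≡ ∑ (λ i → bit (lookup D i))
∣∣-as-∑ []          = refl
∣∣-as-∑ (true  ∷ D) = cong suc (∣∣-as-∑ D)
∣∣-as-∑ (false ∷ D) = ∣∣-as-∑ D

bothIn : ∀ {m n} → Subset m → Subset n → Fin (m * n) → Bool
bothIn {m} {n} D E x = lookup D (quotient n x) ∧ lookup E (remainder {m} n x)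

_⊗_ : ∀ {m n} → Subset m → Subset n → Subset (m * n)
D ⊗ E = tabulate (bothIn D E)

∣⊗∣ : ∀ {m n} (D : Subset m) (E : Subset n) → ∣ D ⊗ E ∣ ≡ ∣ D ∣ * ∣ E ∣
∣⊗∣ {m} {n} D E = begin
  ∣ D ⊗ E ∣                                   ≡⟨ ∣∣-as-∑ (D ⊗ E) ⟩
  ∑ (λ x → bit (lookup (D ⊗ E) x))            ≡⟨ ∑-cong (λ x → cong bit (lookup∘tabulate (bothIn D E) x)) ⟩
  ∑ (λ x → bit (lookup D (quotient n x) ∧ lookup E (remainder {m} n x)))
                                              ≡⟨ ∑-cong (λ x → bit-∧ (lookup D (quotient n x)) _) ⟩
  ∑ (λ x → bit (lookup D (quotient n x)) * bit (lookup E (remainder {m} n x)))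
                                              ≡⟨ ∑-separable (λ i → bit (lookup D i)) (λ j → bit (lookup E j)) ⟩
  ∑ (λ i → bit (lookup D i)) * ∑ (λ j → bit (lookup E j))
                                              ≡⟨ sym (cong₂ _*_ (∣∣-as-∑ D) (∣∣-as-∑ E)) ⟩
  ∣ D ∣ * ∣ E ∣                               ∎
  where open ≡-Reasoning

quotient-combine : ∀ {m n} (i : Fin m) (j : Fin n) → quotient n (combine i j) ≡ i
quotient-combine i j = cong proj₁ (remQuot-combine i j)

remainder-combine : ∀ {m n} (i : Fin m) (j : Fin n) → remainder {m} n (combine i j) ≡ j
remainder-combine i j = cong proj₂ (remQuot-combine i j)

combine∈⊗ : ∀ {m n} {D : Subset m} {E : Subset n} {i j} →
  i ∈ D → j ∈ E → combine i j ∈ D ⊗ E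
combine∈⊗ {m} {n} {D} {E} {i} {j} i∈D j∈E = lookup⇒[]= (combine i j) (D ⊗ E) (begin
  lookup (D ⊗ E) (combine i j)                                     ≡⟨ lookup∘tabulate (bothIn D E) (combine i j) ⟩
  lookup D (quotient n (combine i j)) ∧ lookup E (remainder {m} n (combine i j))
                                                                   ≡⟨ cong₂ _∧_ (cong (lookup D) (quotient-combine i j))
                                                                                (cong (lookup E) (remainder-combine i j)) ⟩
  lookup D i ∧ lookup E j                                          ≡⟨ cong₂ _∧_ ([]=⇒lookup i∈D) ([]=⇒lookup j∈E) ⟩
  true                                                             ∎)
  where open ≡-Reasoning

-- Fact (2): the product of total dominating sets totally dominates G × H,
-- since a neighbour of (g, h) is any pair of neighbours of g and of h.
⊗-totalDominating : ∀ (G H : Graph) {D E} → IsTotalDominating G D → IsTotalDominating H E →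
  IsTotalDominating (G ×ᵍ H) (D ⊗ E)
⊗-totalDominating G H domG domH v
  with domG (quotient (n H) v) | domH (remainder {n G} (n H) v)
... | i , i∈D , vi | j , j∈E , vj =
  combine i j , combine∈⊗ i∈D j∈E ,
  subst (Adj G (quotient (n H) v)) (sym (quotient-combine i j)) vi ,
  subst (Adj H (remainder {n G} (n H) v)) (sym (remainder-combine i j)) vj

label : Bool → Fin 3
label true  = Fin.fromℕ 2
label false = Fin.zero

label-value : ∀ b → toℕ (label b) ≡ 2 * bit b
label-value true  = refl
label-value false = refl

twiceOn : ∀ {m} → Subset m → Fin m → Fin 3
twiceOn D x = label (lookup D x)

twiceOn-weight : ∀ (P : Graph) (D : Subset (n P)) → weight P (twiceOn D) ≡ 2 * ∣ D ∣
twiceOn-weight P D = begin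
  ∑ (λ x → toℕ (label (lookup D x))) ≡⟨ ∑-cong (λ x → label-value (lookup D x)) ⟩
  ∑ (λ x → 2 * bit (lookup D x))     ≡⟨ ∑-*ˡ 2 (λ x → bit (lookup D x)) ⟩
  2 * ∑ (λ x → bit (lookup D x))     ≡⟨ cong (2 *_) (sym (∣∣-as-∑ D)) ⟩
  2 * ∣ D ∣                          ∎
  where open ≡-Reasoning

-- Fact (1): twice a total dominating set is a total Roman dominating function;
-- both TRDF conditions hold because every vertex has a neighbour labelled 2.
twiceOn-TRDF : ∀ (P : Graph) (D : Subset (n P)) → IsTotalDominating P D → IsTRDF P (twiceOn D)
twiceOn-TRDF P D dom = (λ v _ → neighbourLabelled2 v) , λ v _ → nonzero (neighbourLabelled2 v)
  where
  neighbourLabelled2 : ∀ v → ∃ λ u → Adj P v u × toℕ (twiceOn D u) ≡ 2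
  neighbourLabelled2 v with dom v
  ... | u , u∈D , vu = u , vu , cong (λ b → toℕ (label b)) ([]=⇒lookup u∈D)
  nonzero : ∀ {v} → (∃ λ u → Adj P v u × toℕ (twiceOn D u) ≡ 2) →
            ∃ λ u → Adj P v u × toℕ (twiceOn D u) ≢ 0
  nonzero (u , vu , is2) = u , vu , λ is0 → 2≢0 (trans (sym is2) is0)
    where
    2≢0 : 2 ≢ 0
    2≢0 ()

γtR≤2∣D∣ : ∀ (P : Graph) {g} {D : Subset (n P)} →
  IsTotalRomanDomNumber P g → IsTotalDominating P D → g ≤ 2 * ∣ D ∣
γtR≤2∣D∣ P {g} {D} (_ , minimal) dom =
  subst (g ≤_) (twiceOn-weight P D) (minimal (twiceOn D) (twiceOn-TRDF P D dom))

-- Efficient open dominating sets D, E are total dominating, so (1) and (2)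
-- give γ_tR(G × H) ≤ 2∣D∣∣E∣; being open packings, ∣D∣ ≤ k and ∣E∣ ≤ l.
-- (The absence of isolated vertices is implied by total domination.)
corollary5 : (G H : Graph) → NoIsolated G → NoIsolated H →
    IsEfficientOpenDomination G → IsEfficientOpenDomination H →
    ∀ (k l g : ℕ) → IsOpenPackingNumber G k → IsOpenPackingNumber H l →
    IsTotalRomanDomNumber (G ×ᵍ H) g → g ≤ 2 * k * l
corollary5 G H _ _ (D , domD , packD) (E , domE , packE) k l g (_ , maxG) (_ , maxH) γ = begin
  g                   ≤⟨ γtR≤2∣D∣ (G ×ᵍ H) γ (⊗-totalDominating G H domD domE) ⟩
  2 * ∣ D ⊗ E ∣       ≡⟨ cong (2 *_) (∣⊗∣ D E) ⟩
  2 * (∣ D ∣ * ∣ E ∣) ≤⟨ *-monoʳ-≤ 2 (*-mono-≤ (maxG D packD) (maxH E packE)) ⟩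
  2 * (k * l)         ≡⟨ sym (*-assoc 2 k l) ⟩
  2 * k * l           ∎
  where open ≤-Reasoning
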